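{- Let $k\ge3$ and let $u$ be a factor of $\mathbf{t}$ with $2^k-1\le|u|\le3\cdot2^{k-1}$. Then $\mathrm{Cut}_k(u)$ is not a singleton if and only if $u$ is a factor of $\varphi^{k-1}(010)$ or of $\varphi^{k-1}(101)$; in that case $\mathrm{Cut}_k(u)=\{C_1,C_2\}$ with $|\min C_1-\min C_2|=2^{k-1}$. Moreover, in that case, letting $(p_1,s_1)$ and $(p_2,s_2)$ be the factorizations of order $k$ associated with $C_1$ and $C_2$ and assuming without loss of generality $|p_1|<|p_2|$, there exists $a\in A$ such that either $|p_1|+|s_1|=|p_2|+|s_2|$ and $(p_2,\varphi^{k-1}(a)s_2)=(p_1\varphi^{k-1}(a),s_1)$, or $\bigl||p_1|+|s_1|-(|p_2|+|s_2|)\bigr|=2^k$ and $(p_2,s_2)=(p_1\varphi^{k-1}(\bar a),\varphi^{k-1}(a)s_1)$.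
   Context: $A=\{0,1\}$, $\varphi(0)=01$, $\varphi(1)=10$; $\bar a$ is the complement of the letter $a$. $\mathbf{t}$ is the fixed point of $\varphi$ starting with $0$, letters indexed from $0$, $\mathbf{t}_{[i,j)}$ is the factor at positions $i,\ldots,j-1$. For a factor $u$, $\mathrm{Cut}_k(u)=\{([i,i+|u|]\cap 2^k\mathbb{N})-i : i\in\mathbb{N},\ u=\mathbf{t}_{[i,i+|u|)}\}$. If $|u|\ge2^k-1$ and $C\in\mathrm{Cut}_k(u)$, there are unique words $p,s,v$ with $u=p\varphi^k(v)s$, $|p|=\min C$, $|s|=|u|-\max C$, where $p$ is empty or a proper suffix of some $\varphi^k(a)$ and $s$ is empty or a proper prefix of some $\varphi^k(b)$; $(p,s)$ is called the factorization of order $k$ associated with $C$. -}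

module Defs where

open import Data.Bool using (Bool; true; false; not)
open import Data.Nat using (ℕ; zero; suc; _+_; _*_; _^_; _⊓_; _⊔_)
open import Data.Nat.Divisibility using (_∣_; _∣?_)
open import Data.List using (List; []; _∷_; _++_; map; concatMap; upTo; filter; length; take; drop; foldr)
open import Data.Product using (Σ; ∃; _×_; _,_)
open import Relation.Binary.PropositionalEquality using (_≡_)

-- Letters: A = {0,1} represented by Bool, with 0 = false, 1 = true.
-- The complement of a letter is `not`.
Letter : Set
Letter = Bool

Word : Set
Word = List Letter

φ₁ : Letter → Word
φ₁ a = a ∷ not a ∷ []

φ : Word → Word
φ = concatMap φ₁

φ^ : ℕ → Word → Word
φ^ zero    w = w
φ^ (suc k) w = φ (φ^ k w)

-- i-th letter of a word, with a default (only used within bounds).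
at : Word → ℕ → Letter
at []       _       = false
at (x ∷ _)  zero    = x
at (_ ∷ xs) (suc n) = at xs n

-- The fixed point t of φ starting with 0: t is the limit of φ^n(0);
-- since |φ^(n+1)(0)| = 2^(n+1) > n, letter n of t is letter n of φ^(n+1)(0).
𝐭 : ℕ → Letter
𝐭 n = at (φ^ (suc n) (false ∷ [])) n

tFactor : ℕ → ℕ → Word
tFactor i n = map (λ m → 𝐭 (i + m)) (upTo n)

IsFactorT : Word → Set
IsFactorT u = ∃ λ i → u ≡ tFactor i (length u)

IsFactorOf : Word → Word → Set
IsFactorOf u w = Σ Word λ x → Σ Word λ y → w ≡ x ++ u ++ y

-- A cut set ([i, i+n] ∩ 2^k ℕ) − i, a finite subset of ℕ represented
-- canonically as the increasing list of its elements.
cutAt : ℕ → ℕ → ℕ → List ℕ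
cutAt k i n = filter (λ j → (2 ^ k) ∣? (i + j)) (upTo (suc n))

InCut : ℕ → Word → List ℕ → Set
InCut k u C = ∃ λ i → (u ≡ tFactor i (length u)) × (C ≡ cutAt k i (length u))

IsSingleton : {X : Set} → (X → Set) → Set
IsSingleton {X} S = Σ X λ C → S C × (∀ C′ → S C′ → C′ ≡ C)

minL : List ℕ → ℕ
minL []       = 0
minL (x ∷ xs) = foldr _⊓_ x xs

maxL : List ℕ → ℕ
maxL = foldr _⊔_ 0

-- Factorization (p, s) of order k of u associated with the cut C:
-- u = p φ^k(v) s with |p| = min C and |s| = |u| − max C.
facP : List ℕ → Word → Word
facP C u = take (minL C) u

facS : List ℕ → Word → Word
facS C u = drop (maxL C) u

-- Recognizability of φ: two occurrences of a factor of t of length at least 3·2^(j-1) + 1 are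
-- congruent modulo 2^j. With j = k - 1, the occurrences of u therefore fall into at most two classes
-- modulo 2^k, and Cut_k(u) depends only on the class. If both classes occur, u sits at the same offset
-- inside blocks φ^j(t_M) with M of opposite parities; comparing these blocks letter by letter shows
-- that u lies within three consecutive blocks spelling φ^j(a ā a). Conversely, φ^j(a ā a) occurs at an
-- even and at an odd block position of t, so each of its factors meets both classes; the two cut sets
-- start m and m + 2^j positions into u and are computed explicitly, and the length of u decides which
-- of the two shapes the factorizations take.

module Submission where

open import Defs
open import Data.Bool using (Bool; true; false; not; _xor_)
open import Data.Bool.Properties as Bool
  using (not-involutive; not-injective; not-¬; xor-identityʳ; not-distribʳ-xor)
open import Data.Nat
open import Data.Nat.Properties
open import Data.Nat.DivMod using (_/_; _%_; m≡m%n+[m/n]*n; [m+kn]%n≡m%n; m%n<n)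
open import Data.Nat.Tactic.RingSolver using (solve-∀)
open import Data.Nat.Divisibility using (_∣_; _∣?_; ∣-refl; ∣m∣n⇒∣m+n; ∣m+n∣m⇒∣n; m∣m*n; ∣⇒≤)
open import Data.List using (List; []; _∷_; _++_; length; upTo; applyUpTo; take; drop; filter)
open import Data.List.Properties
  using ( ++-assoc; ++-identityʳ; length-++; concatMap-++; map-applyUpTo; ∷-injective; ∷-injectiveˡ; ∷-injectiveʳ
        ; upTo-∷ʳ; filter-++; filter-accept; filter-reject; filter-≐
        ; take-[]; take++drop≡id; drop-drop; length-take; length-drop)
open import Data.List.Relation.Binary.Infix.Heterogeneous using (Infix; MkView; toView; fromView)
open import Data.List.Relation.Binary.Infix.Heterogeneous.Properties using (infix?)
open import Data.List.Relation.Binary.Pointwise using (Pointwise-≡⇒≡; ≡⇒Pointwise-≡)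
open import Data.Product using (Σ; ∃; ∃₂; _×_; _,_)
open import Data.Sum using (_⊎_; inj₁; inj₂)
open import Data.Empty using (⊥; ⊥-elim)
open import Function using (_∘_)
open import Relation.Binary.PropositionalEquality
open import Relation.Nullary using (¬_; Dec; yes; no)
open import Relation.Nullary.Decidable using (map′; _⊎-dec_)
open import Function.Bundles using (_⇔_; mk⇔; Equivalence)

double : ℕ → ℕ
double zero    = zero
double (suc n) = suc (suc (double n))

double≡2* : ∀ n → double n ≡ 2 * n
double≡2* zero    = refl
double≡2* (suc n) = trans (cong (suc ∘ suc) (double≡2* n)) (sym (*-suc 2 n))

double-+ : ∀ m n → double m + double n ≡ double (m + n)
double-+ zero    n = refl
double-+ (suc m) n = cong (suc ∘ suc) (double-+ m n)

suc-double-< : ∀ {m n} → m < n → suc (double m) < double n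
suc-double-< {zero}  {suc n} _         = s≤s (s≤s z≤n)
suc-double-< {suc m} {suc n} (s≤s m<n) = s≤s (s≤s (suc-double-< m<n))

double-cancel-< : ∀ {m n} → double m < double n → m < n
double-cancel-< {zero}  {suc n} _                = s≤s z≤n
double-cancel-< {suc m} {suc n} (s≤s (s≤s m<n)) = s≤s (double-cancel-< m<n)

2^suc≡double : ∀ j → 2 ^ suc j ≡ double (2 ^ j)
2^suc≡double j = sym (double≡2* (2 ^ j))

*-double : ∀ h a → h * double a ≡ 2 * h * a
*-double h a = trans (cong (h *_) (double≡2* a)) (solve h a)
  where
  solve : ∀ h a → h * (2 * a) ≡ 2 * h * a
  solve = solve-∀

*-suc-double : ∀ h a → h * suc (double a) ≡ h + 2 * h * a
*-suc-double h a = trans (*-suc h (double a)) (cong (h +_) (*-double h a))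

even⊎odd : ∀ n → (∃ λ q → n ≡ double q) ⊎ (∃ λ q → n ≡ suc (double q))
even⊎odd zero = inj₁ (0 , refl)
even⊎odd (suc n) with even⊎odd n
... | inj₁ (q , n≡2q)   = inj₂ (q , cong suc n≡2q)
... | inj₂ (q , n≡2q+1) = inj₁ (suc q , cong suc n≡2q+1)

2^>0 : ∀ j → 0 < 2 ^ j
2^>0 = m^n>0 2

n<2^n : ∀ n → n < 2 ^ n
n<2^n zero    = s≤s z≤n
n<2^n (suc n) = +-mono-≤ (2^>0 n) (≤-trans (n<2^n n) (m≤m+n (2 ^ n) 0))

-- The Thue–Morse word

φ-++ : ∀ x y → φ (x ++ y) ≡ φ x ++ φ y
φ-++ = concatMap-++ φ₁

φ^-++ : ∀ j x y → φ^ j (x ++ y) ≡ φ^ j x ++ φ^ j y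
φ^-++ zero    x y = refl
φ^-++ (suc j) x y = trans (cong φ (φ^-++ j x y)) (φ-++ (φ^ j x) (φ^ j y))

length-φ : ∀ w → length (φ w) ≡ double (length w)
length-φ []      = refl
length-φ (a ∷ w) = cong (suc ∘ suc) (length-φ w)

φ^-letter : ∀ j a → ∃ λ w → φ^ j (a ∷ []) ≡ a ∷ w
φ^-letter zero    a = [] , refl
φ^-letter (suc j) a with φ^-letter j a
... | w , eq = not a ∷ φ w , cong φ eq

φ^-letter-injective : ∀ j {a b} → φ^ j (a ∷ []) ≡ φ^ j (b ∷ []) → a ≡ b
φ^-letter-injective j {a} {b} eq with φ^-letter j a | φ^-letter j b
... | w , eqa | w′ , eqb = ∷-injectiveˡ (trans (sym eqa) (trans eq eqb))

tPrefix : ℕ → Word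
tPrefix N = φ^ N (false ∷ [])

length-tPrefix : ∀ N → length (tPrefix N) ≡ 2 ^ N
length-tPrefix zero    = refl
length-tPrefix (suc N) =
  trans (length-φ (tPrefix N)) (trans (double≡2* _) (cong (2 *_) (length-tPrefix N)))

tPrefix-extends : ∀ N → ∃ λ X → tPrefix (suc N) ≡ tPrefix N ++ X
tPrefix-extends zero = true ∷ [] , refl
tPrefix-extends (suc N) with tPrefix-extends N
... | X , eq = φ X , trans (cong φ eq) (φ-++ (tPrefix N) X)

at-++ˡ : ∀ (xs ys : Word) {n} → n < length xs → at (xs ++ ys) n ≡ at xs n
at-++ˡ (x ∷ xs) ys {zero}  _         = refl
at-++ˡ (x ∷ xs) ys {suc n} (s≤s n<) = at-++ˡ xs ys n<

at-φ-double : ∀ (w : Word) {n} → n < length w → at (φ w) (double n) ≡ at w n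
at-φ-double (a ∷ w) {zero}  _         = refl
at-φ-double (a ∷ w) {suc n} (s≤s n<) = at-φ-double w n<

at-φ-suc-double : ∀ (w : Word) {n} → n < length w → at (φ w) (suc (double n)) ≡ not (at w n)
at-φ-suc-double (a ∷ w) {zero}  _         = refl
at-φ-suc-double (a ∷ w) {suc n} (s≤s n<) = at-φ-suc-double w n<

at-tPrefix-+ : ∀ N d {n} → n < 2 ^ N → at (tPrefix (N + d)) n ≡ at (tPrefix N) n
at-tPrefix-+ N zero    {n} _ = cong (λ M → at (tPrefix M) n) (+-identityʳ N)
at-tPrefix-+ N (suc d) {n} n< with tPrefix-extends (N + d)
... | X , eq = begin
    at (tPrefix (N + suc d)) n   ≡⟨ cong (λ M → at (tPrefix M) n) (+-suc N d) ⟩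
    at (tPrefix (suc (N + d))) n ≡⟨ cong (λ w → at w n) eq ⟩
    at (tPrefix (N + d) ++ X) n  ≡⟨ at-++ˡ (tPrefix (N + d)) X n<length ⟩
    at (tPrefix (N + d)) n       ≡⟨ at-tPrefix-+ N d n< ⟩
    at (tPrefix N) n             ∎
  where
  open ≡-Reasoning
  n<length : n < length (tPrefix (N + d))
  n<length = subst (n <_) (sym (length-tPrefix (N + d)))
                   (<-≤-trans n< (^-monoʳ-≤ 2 (m≤m+n N d)))

n<2^suc-n : ∀ n → n < 2 ^ suc n
n<2^suc-n n = <-trans (n<1+n n) (n<2^n (suc n))

𝐭≡at-tPrefix : ∀ {n} N → n < 2 ^ N → 𝐭 n ≡ at (tPrefix N) n
𝐭≡at-tPrefix {n} N n< = begin
  at (tPrefix (suc n)) n     ≡⟨ at-tPrefix-+ (suc n) N (n<2^suc-n n) ⟨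
  at (tPrefix (suc n + N)) n ≡⟨ cong (λ M → at (tPrefix M) n) (+-comm (suc n) N) ⟩
  at (tPrefix (N + suc n)) n ≡⟨ at-tPrefix-+ N (suc n) n< ⟩
  at (tPrefix N) n           ∎
  where open ≡-Reasoning

private
  suc-double<2^ : ∀ m → suc (double m) < 2 ^ suc (suc m)
  suc-double<2^ m = subst (suc (double m) <_) (double≡2* (2 ^ suc m)) (suc-double-< (n<2^suc-n m))

  n<length-tPrefix : ∀ m → m < length (tPrefix (suc m))
  n<length-tPrefix m = subst (m <_) (sym (length-tPrefix (suc m))) (n<2^suc-n m)

𝐭-double : ∀ m → 𝐭 (double m) ≡ 𝐭 m
𝐭-double m = trans (𝐭≡at-tPrefix (suc (suc m)) (<-trans (n<1+n _) (suc-double<2^ m)))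
                   (at-φ-double (tPrefix (suc m)) (n<length-tPrefix m))

𝐭-suc-double : ∀ m → 𝐭 (suc (double m)) ≡ not (𝐭 m)
𝐭-suc-double m = trans (𝐭≡at-tPrefix (suc (suc m)) (suc-double<2^ m))
                       (at-φ-suc-double (tPrefix (suc m)) (n<length-tPrefix m))

2^suc*+double≡double : ∀ j p q → 2 ^ suc j * p + double q ≡ double (2 ^ j * p + q)
2^suc*+double≡double j p q = begin
  2 * 2 ^ j * p + double q ≡⟨ cong (2 * 2 ^ j * p +_) (double≡2* q) ⟩
  2 * 2 ^ j * p + 2 * q    ≡⟨ solve (2 ^ j) p q ⟩
  2 * (2 ^ j * p + q)      ≡⟨ double≡2* _ ⟨
  double (2 ^ j * p + q)   ∎
  where
  open ≡-Reasoning
  solve : ∀ h p q → 2 * h * p + 2 * q ≡ 2 * (h * p + q)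
  solve = solve-∀

xor-cancelʳ : ∀ c {a b} → a xor c ≡ b xor c → a ≡ b
xor-cancelʳ c {false} {false} _  = refl
xor-cancelʳ c {true}  {true}  _  = refl
xor-cancelʳ c {false} {true}  eq = ⊥-elim (not-¬ refl eq)
xor-cancelʳ c {true}  {false} eq = ⊥-elim (not-¬ refl (sym eq))

𝐭-2^*+ : ∀ j p {r} → r < 2 ^ j → 𝐭 (2 ^ j * p + r) ≡ 𝐭 p xor 𝐭 r
𝐭-2^*+ zero p {zero} _ = trans (cong 𝐭 (trans (+-identityʳ _) (+-identityʳ p))) (sym (xor-identityʳ (𝐭 p)))
𝐭-2^*+ zero p {suc r} (s≤s ())
𝐭-2^*+ (suc j) p {r} r< with even⊎odd r
... | inj₁ (q , refl) = begin
    𝐭 (2 ^ suc j * p + double q) ≡⟨ cong 𝐭 (2^suc*+double≡double j p q) ⟩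
    𝐭 (double (2 ^ j * p + q))   ≡⟨ 𝐭-double (2 ^ j * p + q) ⟩
    𝐭 (2 ^ j * p + q)            ≡⟨ 𝐭-2^*+ j p (double-cancel-< (subst (_ <_) (2^suc≡double j) r<)) ⟩
    𝐭 p xor 𝐭 q                  ≡⟨ cong (𝐭 p xor_) (𝐭-double q) ⟨
    𝐭 p xor 𝐭 (double q)         ∎
  where open ≡-Reasoning
... | inj₂ (q , refl) = begin
    𝐭 (2 ^ suc j * p + suc (double q)) ≡⟨ cong 𝐭 (trans (+-suc _ (double q)) (cong suc (2^suc*+double≡double j p q))) ⟩
    𝐭 (suc (double (2 ^ j * p + q)))   ≡⟨ 𝐭-suc-double (2 ^ j * p + q) ⟩
    not (𝐭 (2 ^ j * p + q))            ≡⟨ cong not (𝐭-2^*+ j p q<) ⟩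
    not (𝐭 p xor 𝐭 q)                  ≡⟨ not-distribʳ-xor (𝐭 p) (𝐭 q) ⟩
    𝐭 p xor not (𝐭 q)                  ≡⟨ cong (𝐭 p xor_) (𝐭-suc-double q) ⟨
    𝐭 p xor 𝐭 (suc (double q))         ∎
  where
  open ≡-Reasoning
  q< : q < 2 ^ j
  q< = double-cancel-< (<-trans (n<1+n _) (subst (_ <_) (2^suc≡double j) r<))

factor : ℕ → ℕ → Word
factor i zero    = []
factor i (suc n) = 𝐭 i ∷ factor (suc i) n

applyUpTo≡factor : ∀ (f : ℕ → Letter) i n → (∀ m → f m ≡ 𝐭 (i + m)) → applyUpTo f n ≡ factor i n
applyUpTo≡factor f i zero    f≗ = refl
applyUpTo≡factor f i (suc n) f≗ =
  cong₂ _∷_ (trans (f≗ 0) (cong 𝐭 (+-identityʳ i)))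
            (applyUpTo≡factor (f ∘ suc) (suc i) n (λ m → trans (f≗ (suc m)) (cong 𝐭 (+-suc i m))))

tFactor≡factor : ∀ i n → tFactor i n ≡ factor i n
tFactor≡factor i n =
  trans (map-applyUpTo (λ m → m) (λ m → 𝐭 (i + m)) n) (applyUpTo≡factor _ i n (λ _ → refl))

length-factor : ∀ i n → length (factor i n) ≡ n
length-factor i zero    = refl
length-factor i (suc n) = cong suc (length-factor (suc i) n)

factor-+ : ∀ i m n → factor i (m + n) ≡ factor i m ++ factor (i + m) n
factor-+ i zero    n = cong (λ b → factor b n) (sym (+-identityʳ i))
factor-+ i (suc m) n =
  cong (𝐭 i ∷_) (trans (factor-+ (suc i) m n) (cong (λ b → factor (suc i) m ++ factor b n) (sym (+-suc i m))))

factor-double : ∀ i n → factor (double i) (double n) ≡ φ (factor i n)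
factor-double i zero    = refl
factor-double i (suc n) =
  cong₂ _∷_ (𝐭-double i) (cong₂ _∷_ (𝐭-suc-double i) (factor-double (suc i) n))

factor-φ^ : ∀ j i n → factor (2 ^ j * i) (2 ^ j * n) ≡ φ^ j (factor i n)
factor-φ^ zero    i n = cong₂ factor (+-identityʳ i) (+-identityʳ n)
factor-φ^ (suc j) i n = begin
  factor (2 ^ suc j * i) (2 ^ suc j * n)         ≡⟨ cong₂ factor (doubled i) (doubled n) ⟩
  factor (double (2 ^ j * i)) (double (2 ^ j * n)) ≡⟨ factor-double (2 ^ j * i) (2 ^ j * n) ⟩
  φ (factor (2 ^ j * i) (2 ^ j * n))             ≡⟨ cong φ (factor-φ^ j i n) ⟩
  φ (φ^ j (factor i n))                          ∎
  where
  open ≡-Reasoning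
  doubled : ∀ x → 2 ^ suc j * x ≡ double (2 ^ j * x)
  doubled x = trans (*-assoc 2 (2 ^ j) x) (sym (double≡2* _))

factor-prefix : ∀ i n (x y : Word) → factor i n ≡ x ++ y → x ≡ factor i (length x)
factor-prefix i n       []      y eq = refl
factor-prefix i (suc n) (a ∷ x) y eq with ∷-injective eq
... | a≡ , eq′ = cong₂ _∷_ (sym a≡) (factor-prefix (suc i) n x y eq′)

factor-suffix : ∀ i n (x y : Word) → factor i n ≡ x ++ y → y ≡ factor (i + length x) (n ∸ length x)
factor-suffix i n       []      y eq = trans (sym eq) (cong (λ b → factor b n) (sym (+-identityʳ i)))
factor-suffix i (suc n) (a ∷ x) y eq =
  trans (factor-suffix (suc i) n x y (∷-injectiveʳ eq)) (cong (λ b → factor b (n ∸ length x)) (sym (+-suc i (length x))))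

take-factor : ∀ i {m n} → m ≤ n → take m (factor i n) ≡ factor i m
take-factor i {m} {n} m≤n = begin
  take m (factor i n)                            ≡⟨ cong (take m ∘ factor i) (m+[n∸m]≡n m≤n) ⟨
  take m (factor i (m + (n ∸ m)))                ≡⟨ cong (take m) (factor-+ i m (n ∸ m)) ⟩
  take m (factor i m ++ factor (i + m) (n ∸ m))  ≡⟨ take-length-++ (factor i m) _ (length-factor i m) ⟩
  factor i m                                     ∎
  where
  open ≡-Reasoning
  take-length-++ : ∀ (x y : Word) {m} → length x ≡ m → take m (x ++ y) ≡ x
  take-length-++ []      y refl = refl
  take-length-++ (a ∷ x) y refl = cong (a ∷_) (take-length-++ x y refl)

drop-factor : ∀ i m n → drop m (factor i n) ≡ factor (i + m) (n ∸ m)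
drop-factor i zero    n       = cong (λ b → factor b n) (sym (+-identityʳ i))
drop-factor i (suc m) zero    = refl
drop-factor i (suc m) (suc n) = trans (drop-factor (suc i) m n) (cong (λ b → factor b (n ∸ m)) (sym (+-suc i m)))

window-factor : ∀ i {p n L} → p + n ≤ L → take n (drop p (factor i L)) ≡ factor (i + p) n
window-factor i {p} {n} {L} le =
  trans (cong (take n) (drop-factor i p L)) (take-factor (i + p) (m+n≤o⇒m≤o∸n n (subst (_≤ L) (+-comm p n) le)))

factor-window-≡ : ∀ {i i′ L} p n → p + n ≤ L → factor i L ≡ factor i′ L →
                  factor (i + p) n ≡ factor (i′ + p) n
factor-window-≡ {i} {i′} p n le eq =
  trans (sym (window-factor i le)) (trans (cong (take n ∘ drop p) eq) (window-factor i′ le))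

block-factor : ∀ j {i n r P} → r + 2 ^ j ≤ n → i + r ≡ 2 ^ j * P →
               take (2 ^ j) (drop r (factor i n)) ≡ φ^ j (𝐭 P ∷ [])
block-factor j {i} {n} {r} {P} le eq = begin
  take (2 ^ j) (drop r (factor i n)) ≡⟨ window-factor i le ⟩
  factor (i + r) (2 ^ j)             ≡⟨ cong₂ factor eq (sym (*-identityʳ (2 ^ j))) ⟩
  factor (2 ^ j * P) (2 ^ j * 1)     ≡⟨ factor-φ^ j P 1 ⟩
  φ^ j (𝐭 P ∷ [])                    ∎
  where open ≡-Reasoning

factor-IsFactorOf : ∀ i {p n L} (z : Word) → p + n ≤ L → IsFactorOf (factor (i + p) n) (factor i L ++ z)
factor-IsFactorOf i {p} {n} {L} z le = factor i p , factor (i + p + n) r ++ z , (begin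
  factor i L ++ z                                                   ≡⟨ cong (λ l → factor i l ++ z) L≡ ⟨
  factor i (p + (n + r)) ++ z                                       ≡⟨ cong (_++ z) (factor-+ i p (n + r)) ⟩
  (factor i p ++ factor (i + p) (n + r)) ++ z                       ≡⟨ cong (λ w → (factor i p ++ w) ++ z) (factor-+ (i + p) n r) ⟩
  (factor i p ++ factor (i + p) n ++ factor (i + p + n) r) ++ z     ≡⟨ ++-assoc (factor i p) _ z ⟩
  factor i p ++ (factor (i + p) n ++ factor (i + p + n) r) ++ z     ≡⟨ cong (factor i p ++_) (++-assoc (factor (i + p) n) _ z) ⟩
  factor i p ++ factor (i + p) n ++ factor (i + p + n) r ++ z       ∎)
  where
  open ≡-Reasoning
  r : ℕ
  r = L ∸ (p + n)
  L≡ : p + (n + r) ≡ L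
  L≡ = trans (sym (+-assoc p n r)) (m+[n∸m]≡n le)

IsFactorOf-factor : ∀ i L u → IsFactorOf u (factor i L) → ∃ λ p → p + length u ≤ L × u ≡ factor (i + p) (length u)
IsFactorOf-factor i L u (x , y , eq) = length x , bound , factor-prefix (i + length x) _ u y (sym suffix)
  where
  suffix : u ++ y ≡ factor (i + length x) (L ∸ length x)
  suffix = factor-suffix i L x (u ++ y) eq
  bound : length x + length u ≤ L
  bound = begin
    length x + length u                ≤⟨ +-monoʳ-≤ (length x) (m≤m+n (length u) (length y)) ⟩
    length x + (length u + length y)   ≡⟨ cong (length x +_) (length-++ u) ⟨
    length x + length (u ++ y)         ≡⟨ length-++ x ⟨
    length (x ++ u ++ y)               ≡⟨ cong length eq ⟨
    length (factor i L)                ≡⟨ length-factor i L ⟩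
    L                                  ∎
    where open ≤-Reasoning

infix 4 _≡_mod_

data _≡_mod_ (x y K : ℕ) : Set where
  witness : ∀ a b → x + K * a ≡ y + K * b → x ≡ y mod K

≡mod-sym : ∀ {K x y} → x ≡ y mod K → y ≡ x mod K
≡mod-sym (witness a b eq) = witness b a (sym eq)

≡mod-trans : ∀ {K x y z} → x ≡ y mod K → y ≡ z mod K → x ≡ z mod K
≡mod-trans {K} {x} {y} {z} (witness a b x≡y) (witness c d y≡z) = witness (a + c) (d + b) (begin
  x + K * (a + c)     ≡⟨ solve x K a c ⟩
  (x + K * a) + K * c ≡⟨ cong (_+ K * c) x≡y ⟩
  (y + K * b) + K * c ≡⟨ solve′ y K b c ⟩
  (y + K * c) + K * b ≡⟨ cong (_+ K * b) y≡z ⟩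
  (z + K * d) + K * b ≡⟨ solve z K d b ⟨
  z + K * (d + b)     ∎)
  where
  open ≡-Reasoning
  solve : ∀ x K a c → x + K * (a + c) ≡ (x + K * a) + K * c
  solve = solve-∀
  solve′ : ∀ y K b c → (y + K * b) + K * c ≡ (y + K * c) + K * b
  solve′ = solve-∀

≡mod1 : ∀ x y → x ≡ y mod 1
≡mod1 x y = witness y x (trans (cong (x +_) (*-identityˡ y)) (trans (+-comm x y) (cong (y +_) (sym (*-identityˡ x)))))

≡mod-double : ∀ {K x y} → x ≡ y mod K → double x ≡ double y mod 2 * K
≡mod-double {K} {x} {y} (witness a b eq) = witness a b (begin
  double x + 2 * K * a ≡⟨ doubled x a ⟩
  2 * (x + K * a)      ≡⟨ cong (2 *_) eq ⟩
  2 * (y + K * b)      ≡⟨ doubled y b ⟨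
  double y + 2 * K * b ∎)
  where
  open ≡-Reasoning
  solve : ∀ x K a → 2 * x + 2 * K * a ≡ 2 * (x + K * a)
  solve = solve-∀
  doubled : ∀ x a → double x + 2 * K * a ≡ 2 * (x + K * a)
  doubled x a = trans (cong (_+ 2 * K * a) (double≡2* x)) (solve x K a)

≡mod-suc-double : ∀ {K x y} → x ≡ y mod K → suc (double x) ≡ suc (double y) mod 2 * K
≡mod-suc-double {K} {x} {y} x≡y with ≡mod-double {K} {x} {y} x≡y
... | witness a b eq = witness a b (cong suc eq)

≡mod-halve : ∀ {h x y} → x ≡ y mod h → x ≡ y mod 2 * h ⊎ x + h ≡ y mod 2 * h
≡mod-halve {h} {x} {y} (witness a b eq) with even⊎odd a | even⊎odd b
... | inj₁ (a′ , refl) | inj₁ (b′ , refl) = inj₁ (witness a′ b′ (begin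
  x + 2 * h * a′         ≡⟨ cong (x +_) (*-double h a′) ⟨
  x + h * double a′      ≡⟨ eq ⟩
  y + h * double b′      ≡⟨ cong (y +_) (*-double h b′) ⟩
  y + 2 * h * b′         ∎))
  where open ≡-Reasoning
... | inj₂ (a′ , refl) | inj₂ (b′ , refl) = inj₁ (witness a′ b′ (+-cancelˡ-≡ h _ _ (begin
  h + (x + 2 * h * a′)        ≡⟨ +-exchange h x _ ⟩
  x + (h + 2 * h * a′)        ≡⟨ cong (x +_) (*-suc-double h a′) ⟨
  x + h * suc (double a′)     ≡⟨ eq ⟩
  y + h * suc (double b′)     ≡⟨ cong (y +_) (*-suc-double h b′) ⟩
  y + (h + 2 * h * b′)        ≡⟨ +-exchange h y _ ⟨
  h + (y + 2 * h * b′)        ∎)))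
  where
  open ≡-Reasoning
  +-exchange : ∀ a b c → a + (b + c) ≡ b + (a + c)
  +-exchange = solve-∀
... | inj₂ (a′ , refl) | inj₁ (b′ , refl) = inj₂ (witness a′ b′ (begin
  x + h + 2 * h * a′          ≡⟨ +-assoc x h _ ⟩
  x + (h + 2 * h * a′)        ≡⟨ cong (x +_) (*-suc-double h a′) ⟨
  x + h * suc (double a′)     ≡⟨ eq ⟩
  y + h * double b′           ≡⟨ cong (y +_) (*-double h b′) ⟩
  y + 2 * h * b′              ∎))
  where open ≡-Reasoning
... | inj₁ (a′ , refl) | inj₂ (b′ , refl) = inj₂ (witness a′ (suc b′) (begin
  x + h + 2 * h * a′          ≡⟨ rotate x h a′ ⟩
  (x + 2 * h * a′) + h        ≡⟨ cong (λ z → x + z + h) (*-double h a′) ⟨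
  (x + h * double a′) + h     ≡⟨ cong (_+ h) eq ⟩
  (y + h * suc (double b′)) + h ≡⟨ cong (λ z → y + z + h) (*-suc-double h b′) ⟩
  (y + (h + 2 * h * b′)) + h  ≡⟨ solve y h b′ ⟩
  y + 2 * h * suc b′          ∎))
  where
  open ≡-Reasoning
  rotate : ∀ x h a → x + h + 2 * h * a ≡ (x + 2 * h * a) + h
  rotate = solve-∀
  solve : ∀ y h b → (y + (h + 2 * h * b)) + h ≡ y + 2 * h * suc b
  solve = solve-∀

≡mod⇒%≡ : ∀ {x y K} .{{_ : NonZero K}} → x ≡ y mod K → x % K ≡ y % K
≡mod⇒%≡ {x} {y} {K} (witness a b eq) = begin
  x % K             ≡⟨ [m+kn]%n≡m%n x a K ⟨
  (x + a * K) % K   ≡⟨ cong (λ z → (x + z) % K) (*-comm a K) ⟩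
  (x + K * a) % K   ≡⟨ cong (_% K) eq ⟩
  (y + K * b) % K   ≡⟨ cong (λ z → (y + z) % K) (*-comm K b) ⟩
  (y + b * K) % K   ≡⟨ [m+kn]%n≡m%n y b K ⟩
  y % K             ∎
  where open ≡-Reasoning

≡mod-scale : ∀ {x y K} h e → x ≡ y mod K → h * x + e ≡ h * y + e mod K * h
≡mod-scale {x} {y} {K} h e (witness a b eq) = witness a b (begin
  h * x + e + K * h * a   ≡⟨ solve h x e K a ⟩
  h * (x + K * a) + e     ≡⟨ cong (λ z → h * z + e) eq ⟩
  h * (y + K * b) + e     ≡⟨ solve h y e K b ⟨
  h * y + e + K * h * b   ∎)
  where
  open ≡-Reasoning
  solve : ∀ h x e K a → h * x + e + K * h * a ≡ h * (x + K * a) + e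
  solve = solve-∀

-- Recognizability

Agree : ℕ → ℕ → ℕ → Set
Agree i i′ n = ∀ r → r < n → 𝐭 (i + r) ≡ 𝐭 (i′ + r)

factor≡⇒Agree : ∀ i i′ n → factor i n ≡ factor i′ n → Agree i i′ n
factor≡⇒Agree i i′ (suc n) eq zero    _         =
  trans (cong 𝐭 (+-identityʳ i)) (trans (∷-injectiveˡ eq) (cong 𝐭 (sym (+-identityʳ i′))))
factor≡⇒Agree i i′ (suc n) eq (suc r) (s≤s r<n) =
  trans (cong 𝐭 (+-suc i r))
        (trans (factor≡⇒Agree (suc i) (suc i′) n (∷-injectiveʳ eq) r r<n) (cong 𝐭 (sym (+-suc i′ r))))

Agree-sym : ∀ {i i′ n} → Agree i i′ n → Agree i′ i n
Agree-sym agree r r<n = sym (agree r r<n)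

Agree-≤ : ∀ {i i′ m n} → m ≤ n → Agree i i′ n → Agree i i′ m
Agree-≤ m≤n agree r r<m = agree r (<-≤-trans r<m m≤n)

Agree-+ˡ : ∀ {i i′ n} → Agree i i′ n → ∀ r → r < n → 𝐭 (r + i) ≡ 𝐭 (r + i′)
Agree-+ˡ {i} {i′} agree r r<n = trans (cong 𝐭 (+-comm r i)) (trans (agree r r<n) (cong 𝐭 (+-comm i′ r)))

𝐭-no-aaa : ∀ m → 𝐭 m ≡ 𝐭 (suc m) → 𝐭 (suc m) ≡ 𝐭 (suc (suc m)) → ⊥
𝐭-no-aaa m e₁ e₂ with even⊎odd m
... | inj₁ (q , refl) = not-¬ refl (trans (sym (𝐭-double q)) (trans e₁ (𝐭-suc-double q)))
... | inj₂ (q , refl) = not-¬ refl (trans (sym (𝐭-double (suc q))) (trans e₂ (𝐭-suc-double (suc q))))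

-- An even and an odd occurrence of a factor of length 4 would force a cube aaa in t.
¬Agree-even-odd : ∀ m m′ → ¬ Agree (double m) (suc (double m′)) 4
¬Agree-even-odd m m′ agree = 𝐭-no-aaa m′ (flip e₀ e₁) (flip e₂ e₃)
  where
  agreeˡ : ∀ r → r < 4 → 𝐭 (r + double m) ≡ 𝐭 (r + suc (double m′))
  agreeˡ = Agree-+ˡ {double m} {suc (double m′)} agree
  e₀ : 𝐭 m ≡ not (𝐭 m′)
  e₀ = trans (sym (𝐭-double m)) (trans (agreeˡ 0 (s≤s z≤n)) (𝐭-suc-double m′))
  e₁ : not (𝐭 m) ≡ 𝐭 (suc m′)
  e₁ = trans (sym (𝐭-suc-double m)) (trans (agreeˡ 1 (s≤s (s≤s z≤n))) (𝐭-double (suc m′)))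
  e₂ : 𝐭 (suc m) ≡ not (𝐭 (suc m′))
  e₂ = trans (sym (𝐭-double (suc m))) (trans (agreeˡ 2 (s≤s (s≤s (s≤s z≤n)))) (𝐭-suc-double (suc m′)))
  e₃ : not (𝐭 (suc m)) ≡ 𝐭 (suc (suc m′))
  e₃ = trans (sym (𝐭-suc-double (suc m))) (trans (agreeˡ 3 (s≤s (s≤s (s≤s (s≤s z≤n))))) (𝐭-double (suc (suc m′))))
  flip : ∀ {a x y} → a ≡ not x → not a ≡ y → x ≡ y
  flip {a} {x} e e′ = trans (sym (not-involutive x)) (trans (cong not (sym e)) e′)

Agree-halve-even : ∀ m m′ {n N} → double N ≤ suc n → Agree (double m) (double m′) n → Agree m m′ N
Agree-halve-even m m′ {n} le agree q q<N = begin
  𝐭 (m + q)                ≡⟨ 𝐭-double (m + q) ⟨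
  𝐭 (double (m + q))       ≡⟨ cong 𝐭 (double-+ m q) ⟨
  𝐭 (double m + double q)  ≡⟨ agree (double q) (≤-pred (≤-trans (suc-double-< q<N) le)) ⟩
  𝐭 (double m′ + double q) ≡⟨ cong 𝐭 (double-+ m′ q) ⟩
  𝐭 (double (m′ + q))      ≡⟨ 𝐭-double (m′ + q) ⟩
  𝐭 (m′ + q)               ∎
  where open ≡-Reasoning

Agree-halve-odd : ∀ m m′ {n N} → double N ≤ suc n → Agree (suc (double m)) (suc (double m′)) n → Agree m m′ N
Agree-halve-odd m m′ {n} le agree q q<N = not-injective (begin
  not (𝐭 (m + q))                ≡⟨ 𝐭-suc-double (m + q) ⟨
  𝐭 (suc (double (m + q)))       ≡⟨ cong (𝐭 ∘ suc) (double-+ m q) ⟨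
  𝐭 (suc (double m + double q))  ≡⟨ agree (double q) (≤-pred (≤-trans (suc-double-< q<N) le)) ⟩
  𝐭 (suc (double m′ + double q)) ≡⟨ cong (𝐭 ∘ suc) (double-+ m′ q) ⟩
  𝐭 (suc (double (m′ + q)))      ≡⟨ 𝐭-suc-double (m′ + q) ⟩
  not (𝐭 (m′ + q))               ∎)
  where open ≡-Reasoning

syncLength : ℕ → ℕ
syncLength zero    = 0
syncLength (suc j) = 3 * 2 ^ j + 1

4≤syncLength : ∀ j → 4 ≤ syncLength (suc j)
4≤syncLength j = +-monoˡ-≤ 1 (*-monoʳ-≤ 3 (2^>0 j))

syncLength≤ : ∀ j {n} → 2 ≤ j → 2 * 2 ^ j ≤ suc n → syncLength j ≤ n
syncLength≤ (suc zero) (s≤s ())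
syncLength≤ (suc (suc k)) {n} _ len = ≤-pred (≤-trans bound len)
  where
  x : ℕ
  x = 2 ^ suc k
  bound : suc (3 * x + 1) ≤ 2 * (2 * x)
  bound = subst₂ _≤_ (solve₁ x) (solve₂ x) (+-monoʳ-≤ (3 * x) (^-monoʳ-≤ 2 {1} {suc k} (s≤s z≤n)))
    where
    solve₁ : ∀ x → 3 * x + 2 ≡ suc (3 * x + 1)
    solve₁ = solve-∀
    solve₂ : ∀ x → 3 * x + x ≡ 2 * (2 * x)
    solve₂ = solve-∀

double-syncLength≤ : ∀ j → double (syncLength j) ≤ suc (syncLength (suc j))
double-syncLength≤ zero    = z≤n
double-syncLength≤ (suc j) = ≤-reflexive (trans (double≡2* _) (solve (2 ^ j)))
  where
  solve : ∀ h → 2 * (3 * h + 1) ≡ suc (3 * (2 * h) + 1)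
  solve = solve-∀

Agree⇒≡mod : ∀ j {i i′ n} → syncLength j ≤ n → Agree i i′ n → i ≡ i′ mod 2 ^ j
Agree⇒≡mod zero    {i} {i′} _ _ = ≡mod1 i i′
Agree⇒≡mod (suc j) {i} {i′} {n} len agree with even⊎odd i | even⊎odd i′
... | inj₁ (m , refl) | inj₁ (m′ , refl) =
  ≡mod-double (Agree⇒≡mod j {m} {m′} ≤-refl (Agree-halve-even m m′ halved agree))
  where
  halved : double (syncLength j) ≤ suc n
  halved = ≤-trans (double-syncLength≤ j) (s≤s len)
... | inj₂ (m , refl) | inj₂ (m′ , refl) =
  ≡mod-suc-double (Agree⇒≡mod j {m} {m′} ≤-refl (Agree-halve-odd m m′ halved agree))
  where
  halved : double (syncLength j) ≤ suc n
  halved = ≤-trans (double-syncLength≤ j) (s≤s len)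
... | inj₁ (m , refl) | inj₂ (m′ , refl) =
  ⊥-elim (¬Agree-even-odd m m′ (Agree-≤ {double m} {suc (double m′)} four≤ agree))
  where
  four≤ : 4 ≤ n
  four≤ = ≤-trans (4≤syncLength j) len
... | inj₂ (m , refl) | inj₁ (m′ , refl) =
  ⊥-elim (¬Agree-even-odd m′ m
    (Agree-sym {suc (double m)} {double m′} (Agree-≤ {suc (double m)} {double m′} four≤ agree)))
  where
  four≤ : 4 ≤ n
  four≤ = ≤-trans (4≤syncLength j) len

Agree⇒blockLetter≡ : ∀ j {i i′ n} r {M M′ s} → Agree i i′ n → r < n → s < 2 ^ j →
                     i + r ≡ 2 ^ j * M + s → i′ + r ≡ 2 ^ j * M′ + s → 𝐭 M ≡ 𝐭 M′
Agree⇒blockLetter≡ j {i} {i′} r {M} {M′} {s} agree r<n s< eq eq′ = xor-cancelʳ (𝐭 s) (begin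
  𝐭 M xor 𝐭 s           ≡⟨ 𝐭-2^*+ j M s< ⟨
  𝐭 (2 ^ j * M + s)     ≡⟨ cong 𝐭 eq ⟨
  𝐭 (i + r)             ≡⟨ agree r r<n ⟩
  𝐭 (i′ + r)            ≡⟨ cong 𝐭 eq′ ⟩
  𝐭 (2 ^ j * M′ + s)    ≡⟨ 𝐭-2^*+ j M′ s< ⟩
  𝐭 M′ xor 𝐭 s          ∎)
  where open ≡-Reasoning

-- Cut sets

cutAt-cong : ∀ k {i i′} n → i ≡ i′ mod 2 ^ k → cutAt k i n ≡ cutAt k i′ n
cutAt-cong k {i} {i′} n i≡i′ =
  filter-≐ (λ r → 2 ^ k ∣? (i + r)) (λ r → 2 ^ k ∣? (i′ + r))
           (transfer i≡i′ , transfer (≡mod-sym i≡i′)) (upTo (suc n))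
  where
  transfer : ∀ {x y} → x ≡ y mod 2 ^ k → ∀ {r} → 2 ^ k ∣ x + r → 2 ^ k ∣ y + r
  transfer {x} {y} (witness a b eq) {r} K∣x+r =
    ∣m+n∣m⇒∣n (subst (2 ^ k ∣_) shift (∣m∣n⇒∣m+n K∣x+r (m∣m*n a))) (m∣m*n b)
    where
    shift : x + r + 2 ^ k * a ≡ 2 ^ k * b + (y + r)
    shift = begin
      x + r + 2 ^ k * a   ≡⟨ +-comm-middle x r _ ⟩
      x + 2 ^ k * a + r   ≡⟨ cong (_+ r) eq ⟩
      y + 2 ^ k * b + r   ≡⟨ solve y (2 ^ k * b) r ⟩
      2 ^ k * b + (y + r) ∎
      where
      open ≡-Reasoning
      +-comm-middle : ∀ x r z → x + r + z ≡ x + z + r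
      +-comm-middle = solve-∀
      solve : ∀ y z r → y + z + r ≡ z + (y + r)
      solve = solve-∀

module _ (k i : ℕ) where
  private
    K : ℕ
    K = 2 ^ k

    cuts : ℕ → List ℕ
    cuts m = filter (λ r → K ∣? (i + r)) (upTo m)

    cuts-suc : ∀ m → cuts (suc m) ≡ cuts m ++ filter (λ r → K ∣? (i + r)) (m ∷ [])
    cuts-suc m = trans (cong (filter (λ r → K ∣? (i + r))) (sym (upTo-∷ʳ m)))
                       (filter-++ (λ r → K ∣? (i + r)) (upTo m) (m ∷ []))

    cuts-suc-accept : ∀ m → K ∣ i + m → cuts (suc m) ≡ cuts m ++ m ∷ []
    cuts-suc-accept m K∣ = trans (cuts-suc m) (cong (cuts m ++_) (filter-accept (λ r → K ∣? (i + r)) K∣))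

    cuts-suc-reject : ∀ m → ¬ K ∣ i + m → cuts (suc m) ≡ cuts m
    cuts-suc-reject m K∤ = trans (cuts-suc m)
      (trans (cong (cuts m ++_) (filter-reject (λ r → K ∣? (i + r)) K∤)) (++-identityʳ (cuts m)))

    cuts-skip : ∀ a d → (∀ r → a ≤ r → r < a + d → ¬ K ∣ i + r) → cuts (a + d) ≡ cuts a
    cuts-skip a zero    _   = cong cuts (+-identityʳ a)
    cuts-skip a (suc d) none = begin
      cuts (a + suc d)   ≡⟨ cong cuts (+-suc a d) ⟩
      cuts (suc (a + d)) ≡⟨ cuts-suc-reject (a + d) (none (a + d) (m≤m+n a d) (+-monoʳ-< a (n<1+n d))) ⟩
      cuts (a + d)       ≡⟨ cuts-skip a d (λ r a≤r r< → none r a≤r (<-trans r< (+-monoʳ-< a (n<1+n d)))) ⟩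
      cuts a             ∎
      where open ≡-Reasoning

    multiples-apart : ∀ {a b} → K ∣ i + a → K ∣ i + b → a < b → K ≤ b ∸ a
    multiples-apart {a} {b} K∣a K∣b a<b =
      ∣⇒≤ ⦃ >-nonZero (m<n⇒0<n∸m a<b) ⦄ (∣m+n∣m⇒∣n (subst (K ∣_) split K∣b) K∣a)
      where
      split : i + b ≡ (i + a) + (b ∸ a)
      split = trans (cong (i +_) (sym (m+[n∸m]≡n (<⇒≤ a<b)))) (sym (+-assoc i a (b ∸ a)))

    no-multiple-within : ∀ {a b} → K ∣ i + a → a < b → b < a + K → ¬ K ∣ i + b
    no-multiple-within {a} {b} K∣a a<b b< K∣b =
      <-irrefl refl (<-≤-trans (subst (b ∸ a <_) (m+n∸m≡n a K) (∸-monoˡ-< b< (<⇒≤ a<b))) (multiples-apart K∣a K∣b a<b))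

    cuts-before : ∀ r → K ∣ i + r → r < K → cuts r ≡ []
    cuts-before r K∣r r<K = cuts-skip 0 r (λ s _ s<r K∣s → no-multiple-within K∣s s<r (<-≤-trans r<K (m≤n+m K s)) K∣r)

    cuts-after : ∀ a → K ∣ i + a → ∀ d → d < K → cuts (suc a + d) ≡ cuts (suc a)
    cuts-after a K∣a d d<K =
      cuts-skip (suc a) d (λ r a<r r< → no-multiple-within K∣a a<r (≤-trans r< (subst (_≤ a + K) (+-suc a d) (+-monoʳ-≤ a d<K))))

    cuts-upto-multiple : ∀ r → K ∣ i + r → r < K → cuts (suc r) ≡ r ∷ []
    cuts-upto-multiple r K∣r r<K = trans (cuts-suc-accept r K∣r) (cong (_++ r ∷ []) (cuts-before r K∣r r<K))

    multiple⇒∣ : ∀ {r c} → i + r ≡ K * c → K ∣ i + r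
    multiple⇒∣ {c = c} eq = subst (K ∣_) (sym eq) (m∣m*n c)

  cutAt-singleton : ∀ {r c n} → i + r ≡ K * c → r < K → r ≤ n → n < r + K → cutAt k i n ≡ r ∷ []
  cutAt-singleton {r} {c} {n} eq r<K r≤n n< = begin
    cuts (suc n)             ≡⟨ cong (cuts ∘ suc) (m+[n∸m]≡n r≤n) ⟨
    cuts (suc r + (n ∸ r))   ≡⟨ cuts-after r K∣r (n ∸ r) (subst (n ∸ r <_) (m+n∸m≡n r K) (∸-monoˡ-< n< r≤n)) ⟩
    cuts (suc r)             ≡⟨ cuts-upto-multiple r K∣r r<K ⟩
    r ∷ []                   ∎
    where
    open ≡-Reasoning
    K∣r : K ∣ i + r
    K∣r = multiple⇒∣ eq

  cutAt-pair : ∀ {r c n} → i + r ≡ K * c → r < K → r + K ≤ n → n < r + K + K → cutAt k i n ≡ r ∷ r + K ∷ []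
  cutAt-pair {r} {c} {n} eq r<K r+K≤n n< = begin
    cuts (suc n)                                  ≡⟨ cong (cuts ∘ suc) (m+[n∸m]≡n r+K≤n) ⟨
    cuts (suc (r + K) + (n ∸ (r + K)))            ≡⟨ cuts-after (r + K) K∣r+K (n ∸ (r + K))
                                                       (subst (n ∸ (r + K) <_) (m+n∸m≡n (r + K) K) (∸-monoˡ-< n< r+K≤n)) ⟩
    cuts (suc (r + K))                            ≡⟨ cuts-suc-accept (r + K) K∣r+K ⟩
    cuts (r + K) ++ r + K ∷ []                    ≡⟨ cong (λ m → cuts m ++ r + K ∷ []) r+K≡ ⟩
    cuts (suc r + (K ∸ 1)) ++ r + K ∷ []          ≡⟨ cong (_++ r + K ∷ []) (cuts-after r K∣r (K ∸ 1) (∸-monoʳ-< {K} {1} {0} (s≤s z≤n) (2^>0 k))) ⟩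
    cuts (suc r) ++ r + K ∷ []                    ≡⟨ cong (_++ r + K ∷ []) (cuts-upto-multiple r K∣r r<K) ⟩
    r ∷ r + K ∷ []                                ∎
    where
    open ≡-Reasoning
    K∣r : K ∣ i + r
    K∣r = multiple⇒∣ eq
    K∣r+K : K ∣ i + (r + K)
    K∣r+K = subst (K ∣_) (+-assoc i r K) (∣m∣n⇒∣m+n K∣r ∣-refl)
    r+K≡ : r + K ≡ suc r + (K ∸ 1)
    r+K≡ = trans (cong (r +_) (sym (m+[n∸m]≡n {1} {K} (2^>0 k)))) (+-suc r (K ∸ 1))

-- Occurrences in different classes

InAlternatingTriple : ℕ → Word → Set
InAlternatingTriple j u =
  IsFactorOf u (φ^ j (false ∷ true ∷ false ∷ [])) ⊎ IsFactorOf u (φ^ j (true ∷ false ∷ true ∷ []))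

InAlternatingTriple-intro : ∀ j a u → IsFactorOf u (φ^ j (a ∷ not a ∷ a ∷ [])) → InAlternatingTriple j u
InAlternatingTriple-intro j false u = inj₁
InAlternatingTriple-intro j true  u = inj₂

IsFactorOf? : ∀ u w → Dec (IsFactorOf u w)
IsFactorOf? u w = map′ fromInfix toInfix (infix? Bool._≟_ u w)
  where
  fromInfix : Infix _≡_ u w → IsFactorOf u w
  fromInfix inf with toView inf
  ... | MkView x pw y = x , y , cong (λ z → x ++ z ++ y) (sym (Pointwise-≡⇒≡ pw))
  toInfix : IsFactorOf u w → Infix _≡_ u w
  toInfix (x , y , eq) = subst (Infix _≡_ u) (sym eq) (fromView (MkView x (≡⇒Pointwise-≡ refl) y))

InAlternatingTriple? : ∀ j u → Dec (InAlternatingTriple j u)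
InAlternatingTriple? j u = IsFactorOf? u _ ⊎-dec IsFactorOf? u _

private
  module Separated (j : ℕ) (2≤j : 2 ≤ j) (P P′ e n : ℕ) (e< : e < 2 ^ j) (len : 2 * 2 ^ j ≤ suc n)
                   (agree : Agree (2 ^ j * double P + e) (2 ^ j * suc (double P′) + e) n) where
    h : ℕ
    h = 2 ^ j
    M : ℕ
    M = double P
    M′ : ℕ
    M′ = suc (double P′)
    α : Letter
    α = 𝐭 P

    h<n : h < n
    h<n = ≤-pred (≤-trans (+-monoˡ-≤ h 2≤h) (subst (_≤ suc n) (cong (h +_) (+-identityʳ h)) len))
      where
      2≤h : 2 ≤ h
      2≤h = ^-monoʳ-≤ 2 (≤-trans (s≤s z≤n) 2≤j)

    h*1< : h * 1 < n + e
    h*1< = subst (_< n + e) (sym (*-identityʳ h)) (≤-trans h<n (m≤m+n n e))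

    blocks-agree : ∀ d → h * d < n + e → 𝐭 (d + M) ≡ 𝐭 (d + M′)
    blocks-agree zero    _  =
      Agree⇒blockLetter≡ j 0 agree (≤-<-trans z≤n h<n) e< (+-identityʳ _) (+-identityʳ _)
    blocks-agree (suc d) lt = Agree⇒blockLetter≡ j r agree r<n (2^>0 j) (aligned M) (aligned M′)
      where
      e≤ : e ≤ h * suc d
      e≤ = ≤-trans (<⇒≤ e<) (m≤m*n h (suc d))
      r : ℕ
      r = h * suc d ∸ e
      r<n : r < n
      r<n = subst (r <_) (m+n∸n≡m n e) (∸-monoˡ-< lt e≤)
      aligned : ∀ X → h * X + e + r ≡ h * (suc d + X) + 0
      aligned X = begin
        h * X + e + r       ≡⟨ +-assoc (h * X) e r ⟩
        h * X + (e + r)     ≡⟨ cong (h * X +_) (m+[n∸m]≡n e≤) ⟩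
        h * X + h * suc d   ≡⟨ solve h X (suc d) ⟩
        h * (suc d + X) + 0 ∎
        where
        open ≡-Reasoning
        solve : ∀ h X D → h * X + h * D ≡ h * (D + X) + 0
        solve = solve-∀

    first-two : factor M 2 ≡ α ∷ not α ∷ []
    first-two = cong₂ _∷_ (𝐭-double P) (cong₂ _∷_ (𝐭-suc-double P) refl)

-- Two occurrences at offset e in blocks of opposite parity agree blockwise; four agreeing
-- blocks are excluded by ¬Agree-even-odd, so u lies within three blocks, which spell a ā a.
separated⇒InAlternatingTriple :
  ∀ j → 2 ≤ j → ∀ P P′ e n → e < 2 ^ j → 2 * 2 ^ j ≤ suc n →
  Agree (2 ^ j * double P + e) (2 ^ j * suc (double P′) + e) n →
  InAlternatingTriple j (factor (2 ^ j * double P + e) n)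
separated⇒InAlternatingTriple j 2≤j P P′ e n e< len agree with n + e ≤? 2 ^ j * 2
... | yes ≤2h = InAlternatingTriple-intro j α _ (subst (IsFactorOf _) two-blocks
      (factor-IsFactorOf (h * M) (φ^ j (α ∷ [])) (subst (_≤ h * 2) (+-comm n e) ≤2h)))
  where
  open Separated j 2≤j P P′ e n e< len agree
  two-blocks : factor (h * M) (h * 2) ++ φ^ j (α ∷ []) ≡ φ^ j (α ∷ not α ∷ α ∷ [])
  two-blocks = trans (cong (_++ φ^ j (α ∷ [])) (trans (factor-φ^ j M 2) (cong (φ^ j) first-two)))
                     (sym (φ^-++ j (α ∷ not α ∷ []) (α ∷ [])))
... | no >2h with n + e ≤? 2 ^ j * 3
... | yes ≤3h = InAlternatingTriple-intro j α _ (subst (IsFactorOf _) three-blocks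
      (factor-IsFactorOf (h * M) [] (subst (_≤ h * 3) (+-comm n e) ≤3h)))
  where
  open Separated j 2≤j P P′ e n e< len agree
  third : 𝐭 (2 + M) ≡ α
  third = begin
    𝐭 (2 + M)                  ≡⟨ blocks-agree 2 (≰⇒> >2h) ⟩
    𝐭 (suc (double (suc P′)))  ≡⟨ 𝐭-suc-double (suc P′) ⟩
    not (𝐭 (suc P′))           ≡⟨ cong not (𝐭-double (suc P′)) ⟨
    not (𝐭 (1 + M′))           ≡⟨ cong not (blocks-agree 1 h*1<) ⟨
    not (𝐭 (1 + M))            ≡⟨ cong not (𝐭-suc-double P) ⟩
    not (not α)                ≡⟨ not-involutive α ⟩
    α                          ∎
    where open ≡-Reasoning
  three-blocks : factor (h * M) (h * 3) ++ [] ≡ φ^ j (α ∷ not α ∷ α ∷ [])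
  three-blocks = trans (++-identityʳ _) (trans (factor-φ^ j M 3)
                   (cong (φ^ j) (cong₂ _∷_ (𝐭-double P) (cong₂ _∷_ (𝐭-suc-double P) (cong₂ _∷_ third refl)))))
... | no >3h = ⊥-elim (¬Agree-even-odd P P′ four-blocks)
  where
  open Separated j 2≤j P P′ e n e< len agree
  four-blocks : Agree M M′ 4
  four-blocks r r<4 = trans (cong 𝐭 (+-comm M r))
    (trans (blocks-agree r (≤-<-trans (*-monoʳ-≤ h (≤-pred r<4)) (≰⇒> >3h))) (cong 𝐭 (+-comm r M′)))

-- Occurrences are congruent modulo 2^j by recognizability; if they are not congruent modulo 2^(j+1),
-- their block indices have opposite parities and u is in an alternating triple.
private
  module SameCut (j : ℕ) (2≤j : 2 ≤ j) {i i′ n : ℕ} (len : 2 * 2 ^ j ≤ suc n) (eq : factor i n ≡ factor i′ n) where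
    h : ℕ
    h = 2 ^ j

    instance
      h≢0 : NonZero h
      h≢0 = m^n≢0 2 j

    e : ℕ
    e = i % h

    agree : Agree i i′ n
    agree = factor≡⇒Agree i i′ n eq

    e≡ : i′ % h ≡ e
    e≡ = sym (≡mod⇒%≡ (Agree⇒≡mod j (syncLength≤ j 2≤j len) agree))

    quotient-remainder : ∀ x → x ≡ h * (x / h) + x % h
    quotient-remainder x = trans (m≡m%n+[m/n]*n x h) (trans (+-comm (x % h) _) (cong (_+ x % h) (*-comm (x / h) h)))

    i≡ : ∀ {M} → i / h ≡ M → i ≡ h * M + e
    i≡ refl = quotient-remainder i

    i′≡ : ∀ {M} → i′ / h ≡ M → i′ ≡ h * M + e
    i′≡ refl = trans (quotient-remainder i′) (cong (h * (i′ / h) +_) e≡)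

    same-class : ∀ {M M′} → i / h ≡ M → i′ / h ≡ M′ → M ≡ M′ mod 2 → cutAt (suc j) i n ≡ cutAt (suc j) i′ n
    same-class M≡ M′≡ M≡M′ =
      cutAt-cong (suc j) n (subst₂ (λ x y → x ≡ y mod 2 * h) (sym (i≡ M≡)) (sym (i′≡ M′≡)) (≡mod-scale h e M≡M′))

    cutAt≡ : ¬ InAlternatingTriple j (factor i n) → cutAt (suc j) i n ≡ cutAt (suc j) i′ n
    cutAt≡ ¬alt with even⊎odd (i / h) | even⊎odd (i′ / h)
    ... | inj₁ (P , M≡) | inj₁ (P′ , M′≡) = same-class M≡ M′≡ (≡mod-double (≡mod1 P P′))
    ... | inj₂ (P , M≡) | inj₂ (P′ , M′≡) = same-class M≡ M′≡ (≡mod-suc-double (≡mod1 P P′))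
    ... | inj₁ (P , M≡) | inj₂ (P′ , M′≡) = ⊥-elim (¬alt (subst (InAlternatingTriple j ∘ λ x → factor x n) (sym (i≡ M≡))
            (separated⇒InAlternatingTriple j 2≤j P P′ e n (m%n<n i h) len
              (subst₂ (λ x y → Agree x y n) (i≡ M≡) (i′≡ M′≡) agree))))
    ... | inj₂ (P , M≡) | inj₁ (P′ , M′≡) = ⊥-elim (¬alt (subst (InAlternatingTriple j)
            (trans (cong (λ x → factor x n) (sym (i′≡ M′≡))) (sym eq))
            (separated⇒InAlternatingTriple j 2≤j P′ P e n (m%n<n i h) len
              (subst₂ (λ x y → Agree x y n) (i′≡ M′≡) (i≡ M≡) (Agree-sym {i} {i′} agree)))))

factor≡⇒cutAt≡ : ∀ j → 2 ≤ j → ∀ {i i′ n} → 2 * 2 ^ j ≤ suc n → ¬ InAlternatingTriple j (factor i n) →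
                 factor i n ≡ factor i′ n → cutAt (suc j) i n ≡ cutAt (suc j) i′ n
factor≡⇒cutAt≡ j 2≤j len ¬alt eq = SameCut.cutAt≡ j 2≤j len eq ¬alt

-- mᵢ and Mᵢ stand for min Cᵢ and max Cᵢ, so that (take mᵢ u , drop Mᵢ u) is the factorization (pᵢ , sᵢ).
RelatedFactorizations : ℕ → Word → ℕ → ℕ → ℕ → ℕ → Set
RelatedFactorizations j u m₁ M₁ m₂ M₂ =
  ∣ m₁ - m₂ ∣ ≡ 2 ^ j
  × length (take m₁ u) < length (take m₂ u)
  × Σ Letter λ a →
      ((length (take m₁ u) + length (drop M₁ u) ≡ length (take m₂ u) + length (drop M₂ u))
       × (take m₂ u ≡ take m₁ u ++ φ^ j (a ∷ []))
       × (φ^ j (a ∷ []) ++ drop M₂ u ≡ drop M₁ u))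
    ⊎ ((∣ (length (take m₁ u) + length (drop M₁ u)) - (length (take m₂ u) + length (drop M₂ u)) ∣ ≡ 2 ^ suc j)
       × (take m₂ u ≡ take m₁ u ++ φ^ j (not a ∷ []))
       × (drop M₂ u ≡ φ^ j (a ∷ []) ++ drop M₁ u))

module _ {A : Set} where
  take-+ : ∀ m h (u : List A) → take (m + h) u ≡ take m u ++ take h (drop m u)
  take-+ zero    h u       = refl
  take-+ (suc m) h []      = sym (take-[] h)
  take-+ (suc m) h (x ∷ u) = cong (x ∷_) (take-+ m h u)

  drop-+ : ∀ m h (u : List A) → drop m u ≡ take h (drop m u) ++ drop (m + h) u
  drop-+ m h u = trans (sym (take++drop≡id h (drop m u))) (cong (take h (drop m u) ++_) (drop-drop m h u))

  length-take-≤ : ∀ {m} (u : List A) → m ≤ length u → length (take m u) ≡ m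
  length-take-≤ {m} u m≤ = trans (length-take m u) (m≤n⇒m⊓n≡m m≤)

∸-split : ∀ {L M h} → M + h ≤ L → L ∸ M ≡ h + (L ∸ (M + h))
∸-split {L} {M} {h} le = begin
  L ∸ M                       ≡⟨ cong (_∸ M) (m+[n∸m]≡n le) ⟨
  M + h + (L ∸ (M + h)) ∸ M   ≡⟨ cong (_∸ M) (+-assoc M h _) ⟩
  M + (h + (L ∸ (M + h))) ∸ M ≡⟨ m+n∸m≡n M _ ⟩
  h + (L ∸ (M + h))           ∎
  where open ≡-Reasoning

shift⇒RelatedFactorizations :
  ∀ j u {m M} a → m ≤ M → M + 2 ^ j ≤ length u →
  take (2 ^ j) (drop m u) ≡ φ^ j (a ∷ []) → take (2 ^ j) (drop M u) ≡ φ^ j (a ∷ []) →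
  RelatedFactorizations j u m M (m + 2 ^ j) (M + 2 ^ j)
shift⇒RelatedFactorizations j u {m} {M} a m≤M M+h≤ block-m block-M =
  ∣m-m+n∣≡n m h , shorter , a , inj₁ (lengths , prefix , suffix)
  where
  h : ℕ
  h = 2 ^ j
  m+h≤ : m + h ≤ length u
  m+h≤ = ≤-trans (+-monoˡ-≤ h m≤M) M+h≤
  shorter : length (take m u) < length (take (m + h) u)
  shorter = subst₂ _<_ (sym (length-take-≤ u (≤-trans (m≤m+n m h) m+h≤))) (sym (length-take-≤ u m+h≤))
                   (m<m+n m (2^>0 j))
  prefix : take (m + h) u ≡ take m u ++ φ^ j (a ∷ [])
  prefix = trans (take-+ m h u) (cong (take m u ++_) block-m)
  suffix : φ^ j (a ∷ []) ++ drop (M + h) u ≡ drop M u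
  suffix = trans (cong (_++ drop (M + h) u) (sym block-M)) (sym (drop-+ M h u))
  lengths : length (take m u) + length (drop M u) ≡ length (take (m + h) u) + length (drop (M + h) u)
  lengths = begin
    length (take m u) + length (drop M u)             ≡⟨ cong₂ _+_ (length-take-≤ u (≤-trans (m≤m+n m h) m+h≤)) (length-drop M u) ⟩
    m + (length u ∸ M)                                ≡⟨ cong (m +_) (∸-split {M = M} {h} M+h≤) ⟩
    m + (h + (length u ∸ (M + h)))                    ≡⟨ +-assoc m h _ ⟨
    m + h + (length u ∸ (M + h))                      ≡⟨ cong₂ _+_ (length-take-≤ u m+h≤) (length-drop (M + h) u) ⟨
    length (take (m + h) u) + length (drop (M + h) u) ∎
    where open ≡-Reasoning

overlap⇒RelatedFactorizations :
  ∀ j u {m} a → m + 2 * 2 ^ j ≤ length u →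
  take (2 ^ j) (drop m u) ≡ φ^ j (not a ∷ []) → take (2 ^ j) (drop (m + 2 ^ j) u) ≡ φ^ j (a ∷ []) →
  RelatedFactorizations j u m (m + 2 * 2 ^ j) (m + 2 ^ j) (m + 2 ^ j)
overlap⇒RelatedFactorizations j u {m} a m+2h≤ block-m block-m+h =
  ∣m-m+n∣≡n m h , shorter , a , inj₂ (lengths , prefix , suffix)
  where
  h : ℕ
  h = 2 ^ j
  m+h+h≡ : m + h + h ≡ m + 2 * h
  m+h+h≡ = solve m h
    where
    solve : ∀ m h → m + h + h ≡ m + 2 * h
    solve = solve-∀
  m+h+h≤ : m + h + h ≤ length u
  m+h+h≤ = subst (_≤ length u) (sym m+h+h≡) m+2h≤
  m+h≤ : m + h ≤ length u
  m+h≤ = ≤-trans (m≤m+n (m + h) h) m+h+h≤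
  shorter : length (take m u) < length (take (m + h) u)
  shorter = subst₂ _<_ (sym (length-take-≤ u (≤-trans (m≤m+n m h) m+h≤))) (sym (length-take-≤ u m+h≤))
                   (m<m+n m (2^>0 j))
  prefix : take (m + h) u ≡ take m u ++ φ^ j (not a ∷ [])
  prefix = trans (take-+ m h u) (cong (take m u ++_) block-m)
  suffix : drop (m + h) u ≡ φ^ j (a ∷ []) ++ drop (m + 2 * h) u
  suffix = trans (drop-+ (m + h) h u) (cong₂ _++_ block-m+h (cong (λ x → drop x u) m+h+h≡))
  X : ℕ
  X = length u ∸ (m + 2 * h)
  lengths : ∣ length (take m u) + length (drop (m + 2 * h) u) - length (take (m + h) u) + length (drop (m + h) u) ∣ ≡ 2 * h
  lengths = begin
    ∣ length (take m u) + length (drop (m + 2 * h) u) - length (take (m + h) u) + length (drop (m + h) u) ∣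
      ≡⟨ cong₂ ∣_-_∣ (cong₂ _+_ (length-take-≤ u (≤-trans (m≤m+n m h) m+h≤)) (length-drop (m + 2 * h) u))
                     (cong₂ _+_ (length-take-≤ u m+h≤) (length-drop (m + h) u)) ⟩
    ∣ m + X - m + h + (length u ∸ (m + h)) ∣
      ≡⟨ cong (λ y → ∣ m + X - m + h + y ∣) (trans (∸-split {M = m + h} {h} m+h+h≤) (cong (λ z → h + (length u ∸ z)) m+h+h≡)) ⟩
    ∣ m + X - m + h + (h + X) ∣   ≡⟨ cong (∣ m + X -_∣) (solve m h X) ⟩
    ∣ m + X - m + X + 2 * h ∣     ≡⟨ ∣m-m+n∣≡n (m + X) (2 * h) ⟩
    2 * h                         ∎
    where
    open ≡-Reasoning
    solve : ∀ m h X → m + h + (h + X) ≡ m + X + 2 * h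
    solve = solve-∀

TwoCuts : ℕ → Word → Set
TwoCuts j u = Σ (List ℕ) λ C₁ → Σ (List ℕ) λ C₂ →
  (∀ C → InCut (suc j) u C ⇔ (C ≡ C₁ ⊎ C ≡ C₂))
  × RelatedFactorizations j u (minL C₁) (maxL C₁) (minL C₂) (maxL C₂)

bounds-singleton : ∀ {C r} → C ≡ r ∷ [] → minL C ≡ r × maxL C ≡ r
bounds-singleton refl = refl , ⊔-identityʳ _

bounds-pair : ∀ {C r s} → r ≤ s → C ≡ r ∷ s ∷ [] → minL C ≡ r × maxL C ≡ s
bounds-pair {r = r} r≤s refl = m≥n⇒m⊓n≡n r≤s , trans (cong (r ⊔_) (⊔-identityʳ _)) (m≤n⇒m⊔n≡n r≤s)

RelatedFactorizations-at-bounds : ∀ {j u C₁ C₂ m₁ M₁ m₂ M₂} →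
  minL C₁ ≡ m₁ × maxL C₁ ≡ M₁ → minL C₂ ≡ m₂ × maxL C₂ ≡ M₂ →
  RelatedFactorizations j u m₁ M₁ m₂ M₂ → RelatedFactorizations j u (minL C₁) (maxL C₁) (minL C₂) (maxL C₂)
RelatedFactorizations-at-bounds (refl , refl) (refl , refl) related = related

-- i₁ and i₂ are occurrences of u in the two classes modulo 2^(j+1), with cut sets starting at m and m + 2^j.
private
  module Offset (j : ℕ) (2≤j : 2 ≤ j) (u : Word) {i₁ i₂ m c₁ c₂ : ℕ}
                (len : 2 * 2 ^ j ≤ suc (length u)) (hi : length u ≤ m + 3 * 2 ^ j) (m< : m < 2 ^ j)
                (u₁ : u ≡ factor i₁ (length u)) (u₂ : u ≡ factor i₂ (length u))
                (eq₁ : i₁ + m ≡ 2 * 2 ^ j * c₁) (eq₂ : i₂ + (m + 2 ^ j) ≡ 2 * 2 ^ j * c₂) where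
    h : ℕ
    h = 2 ^ j
    n : ℕ
    n = length u
    F : Letter → Word
    F a = φ^ j (a ∷ [])
    C₁ : List ℕ
    C₁ = cutAt (suc j) i₁ n
    C₂ : List ℕ
    C₂ = cutAt (suc j) i₂ n

    Related : Set
    Related = RelatedFactorizations j u (minL C₁) (maxL C₁) (minL C₂) (maxL C₂)

    at-bounds : ∀ {m₁ M₁ m₂ M₂} → minL C₁ ≡ m₁ × maxL C₁ ≡ M₁ → minL C₂ ≡ m₂ × maxL C₂ ≡ M₂ →
                RelatedFactorizations j u m₁ M₁ m₂ M₂ → Related
    at-bounds = RelatedFactorizations-at-bounds {j} {u} {C₁} {C₂}

    i₂≡i₁+h : i₂ ≡ i₁ + h mod 2 * h
    i₂≡i₁+h = witness (suc c₁) c₂ (begin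
      i₂ + 2 * h * suc c₁           ≡⟨ cong (i₂ +_) (*-suc (2 * h) c₁) ⟩
      i₂ + (2 * h + 2 * h * c₁)     ≡⟨ cong (λ z → i₂ + (2 * h + z)) eq₁ ⟨
      i₂ + (2 * h + (i₁ + m))       ≡⟨ solve i₁ i₂ m h ⟩
      i₁ + h + (i₂ + (m + h))       ≡⟨ cong (i₁ + h +_) eq₂ ⟩
      i₁ + h + 2 * h * c₂           ∎)
      where
      open ≡-Reasoning
      solve : ∀ i₁ i₂ m h → i₂ + (2 * h + (i₁ + m)) ≡ i₁ + h + (i₂ + (m + h))
      solve = solve-∀

    classes : ∀ C → InCut (suc j) u C ⇔ (C ≡ C₁ ⊎ C ≡ C₂)
    classes C = mk⇔ to from
      where
      to : InCut (suc j) u C → C ≡ C₁ ⊎ C ≡ C₂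
      to (i′ , u′ , C≡) with ≡mod-halve (Agree⇒≡mod j (syncLength≤ j 2≤j len)
                               (factor≡⇒Agree i₁ i′ n (trans (sym u₁) (trans u′ (tFactor≡factor i′ n)))))
      ... | inj₁ i₁≡i′   = inj₁ (trans C≡ (cutAt-cong (suc j) n (≡mod-sym i₁≡i′)))
      ... | inj₂ i₁+h≡i′ = inj₂ (trans C≡ (cutAt-cong (suc j) n (≡mod-sym (≡mod-trans i₂≡i₁+h i₁+h≡i′))))
      from : C ≡ C₁ ⊎ C ≡ C₂ → InCut (suc j) u C
      from (inj₁ refl) = i₁ , trans u₁ (sym (tFactor≡factor i₁ n)) , refl
      from (inj₂ refl) = i₂ , trans u₂ (sym (tFactor≡factor i₂ n)) , refl

    m+h< : m + h < 2 * h
    m+h< = subst (m + h <_) (cong (h +_) (sym (+-identityʳ h))) (+-monoˡ-< h m<)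

    m<2h : m < 2 * h
    m<2h = <-trans (m<m+n m (2^>0 j)) m+h<

    m+h≤n : m + h ≤ n
    m+h≤n = ≤-pred (≤-trans m+h< len)

    m+h+h≡ : m + h + h ≡ m + 2 * h
    m+h+h≡ = solve m h
      where
      solve : ∀ m h → m + h + h ≡ m + 2 * h
      solve = solve-∀

    n<m+2h+2h : n < m + 2 * h + 2 * h
    n<m+2h+2h = subst (n <_) (solve m h) (≤-<-trans hi (m<m+n (m + 3 * h) (2^>0 j)))
      where
      solve : ∀ m h → m + 3 * h + h ≡ m + 2 * h + 2 * h
      solve = solve-∀

    C₁-singleton : n < m + 2 * h → C₁ ≡ m ∷ []
    C₁-singleton n< = cutAt-singleton (suc j) i₁ eq₁ m<2h (≤-trans (m≤m+n m h) m+h≤n) n<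

    C₁-pair : m + 2 * h ≤ n → C₁ ≡ m ∷ m + 2 * h ∷ []
    C₁-pair m+2h≤n = cutAt-pair (suc j) i₁ eq₁ m<2h m+2h≤n n<m+2h+2h

    C₂-singleton : n < m + h + 2 * h → C₂ ≡ m + h ∷ []
    C₂-singleton n< = cutAt-singleton (suc j) i₂ eq₂ m+h< m+h≤n n<

    C₂-pair : m + h + 2 * h ≤ n → C₂ ≡ m + h ∷ m + h + 2 * h ∷ []
    C₂-pair m+3h≤n = cutAt-pair (suc j) i₂ eq₂ m+h< m+3h≤n
      (<-≤-trans n<m+2h+2h (+-monoˡ-≤ (2 * h) (+-monoˡ-≤ (2 * h) (m≤m+n m h))))

    next-block : ∀ x y {c} → x + y ≡ 2 * h * c → x + (y + h) ≡ h * suc (double c)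
    next-block x y {c} eq = trans (sym (+-assoc x y h))
      (trans (cong (_+ h) eq) (trans (+-comm (2 * h * c) h) (sym (*-suc-double h c))))

    first-block : take h (drop m u) ≡ F (𝐭 (double c₁))
    first-block = trans (cong (take h ∘ drop m) u₁) (block-factor j m+h≤n (trans eq₁ (sym (*-double h c₁))))

    second-block₁ : m + 2 * h ≤ n → take h (drop (m + h) u) ≡ F (𝐭 (suc (double c₁)))
    second-block₁ m+2h≤n = trans (cong (take h ∘ drop (m + h)) u₁)
      (block-factor j (subst (_≤ n) (sym m+h+h≡) m+2h≤n) (next-block i₁ m eq₁))

    second-block₂ : m + 2 * h ≤ n → take h (drop (m + h) u) ≡ F (𝐭 (double c₂))
    second-block₂ m+2h≤n = trans (cong (take h ∘ drop (m + h)) u₂)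
      (block-factor j (subst (_≤ n) (sym m+h+h≡) m+2h≤n) (trans eq₂ (sym (*-double h c₂))))

    third-block₂ : m + 2 * h + h ≤ n → take h (drop (m + 2 * h) u) ≡ F (𝐭 (suc (double c₂)))
    third-block₂ m+3h≤n = trans (cong (take h ∘ drop (m + 2 * h)) u₂)
      (block-factor j m+3h≤n (trans (cong (i₂ +_) (sym m+h+h≡)) (next-block i₂ (m + h) eq₂)))

    short : n < m + 2 * h → Related
    short n< = at-bounds (bounds-singleton (C₁-singleton n<)) (bounds-singleton (C₂-singleton n<m+h+2h))
      (shift⇒RelatedFactorizations j u (𝐭 (double c₁)) ≤-refl m+h≤n first-block first-block)
      where
      n<m+h+2h : n < m + h + 2 * h
      n<m+h+2h = <-≤-trans n< (+-monoˡ-≤ (2 * h) (m≤m+n m h))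

    medium : m + 2 * h ≤ n → n < m + 3 * h → Related
    medium m+2h≤n n< = at-bounds (bounds-pair (m≤m+n m (2 * h)) (C₁-pair m+2h≤n)) (bounds-singleton (C₂-singleton n<m+h+2h))
      (overlap⇒RelatedFactorizations j u (𝐭 (suc (double c₁))) m+2h≤n first (second-block₁ m+2h≤n))
      where
      n<m+h+2h : n < m + h + 2 * h
      n<m+h+2h = subst (n <_) (solve m h) n<
        where
        solve : ∀ m h → m + 3 * h ≡ m + h + 2 * h
        solve = solve-∀
      first : take h (drop m u) ≡ F (not (𝐭 (suc (double c₁))))
      first = trans first-block
        (cong F (sym (trans (cong not (𝐭-suc-double c₁)) (trans (not-involutive _) (sym (𝐭-double c₁))))))

    -- Both occurrences read the second block of u, which forces its third block to equal the first.
    long : n ≡ m + 3 * h → Related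
    long n≡ = at-bounds (bounds-pair (m≤m+n m (2 * h)) (C₁-pair m+2h≤n))
      (shift-max (bounds-pair (m≤m+n (m + h) (2 * h)) (C₂-pair (≤-reflexive (trans m+h+2h≡ (sym n≡))))))
      (shift⇒RelatedFactorizations j u (𝐭 (double c₁)) (m≤m+n m (2 * h)) m+2h+h≤n first-block third)
      where
      m+h+2h≡ : m + h + 2 * h ≡ m + 3 * h
      m+h+2h≡ = solve m h
        where
        solve : ∀ m h → m + h + 2 * h ≡ m + 3 * h
        solve = solve-∀
      m+2h+h≡ : m + 2 * h + h ≡ m + h + 2 * h
      m+2h+h≡ = solve m h
        where
        solve : ∀ m h → m + 2 * h + h ≡ m + h + 2 * h
        solve = solve-∀
      m+2h+h≤n : m + 2 * h + h ≤ n
      m+2h+h≤n = ≤-reflexive (trans m+2h+h≡ (trans m+h+2h≡ (sym n≡)))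
      m+2h≤n : m + 2 * h ≤ n
      m+2h≤n = ≤-trans (m≤m+n (m + 2 * h) h) m+2h+h≤n
      shift-max : minL C₂ ≡ m + h × maxL C₂ ≡ m + h + 2 * h → minL C₂ ≡ m + h × maxL C₂ ≡ m + 2 * h + h
      shift-max (min≡ , max≡) = min≡ , trans max≡ (sym m+2h+h≡)
      middle : 𝐭 (double c₂) ≡ 𝐭 (suc (double c₁))
      middle = φ^-letter-injective j (trans (sym (second-block₂ m+2h≤n)) (second-block₁ m+2h≤n))
      third : take h (drop (m + 2 * h) u) ≡ F (𝐭 (double c₁))
      third = trans (third-block₂ m+2h+h≤n) (cong F (begin
        𝐭 (suc (double c₂))         ≡⟨ 𝐭-suc-double c₂ ⟩
        not (𝐭 c₂)                  ≡⟨ cong not (𝐭-double c₂) ⟨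
        not (𝐭 (double c₂))         ≡⟨ cong not middle ⟩
        not (𝐭 (suc (double c₁)))   ≡⟨ cong not (𝐭-suc-double c₁) ⟩
        not (not (𝐭 c₁))            ≡⟨ not-involutive _ ⟩
        𝐭 c₁                        ≡⟨ 𝐭-double c₁ ⟨
        𝐭 (double c₁)               ∎))
        where open ≡-Reasoning

    twoCuts : TwoCuts j u
    twoCuts = C₁ , C₂ , classes , related
      where
      related : Related
      related with m + 2 * h ≤? n
      ... | no  n≱ = short (≰⇒> n≱)
      ... | yes m+2h≤n with m≤n⇒m<n∨m≡n hi
      ...   | inj₁ n< = medium m+2h≤n n<
      ...   | inj₂ n≡ = long n≡

-- t = 0110100110010110…: 010 occurs at positions 10 and 3, and 101 at positions 2 and 11.
aāa-occurrences : ∀ a → ∃₂ λ c c′ →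
  factor (2 * c) 3 ≡ a ∷ not a ∷ a ∷ [] × factor (1 + 2 * c′) 3 ≡ a ∷ not a ∷ a ∷ []
aāa-occurrences false = 5 , 1 , refl , refl
aāa-occurrences true  = 1 , 5 , refl , refl

private
  module OffsetArithmetic where
    at-start₁ : ∀ h c → h * (2 * c) + 0 + 0 ≡ 2 * h * c
    at-start₁ = solve-∀
    at-start₂ : ∀ h c → h * (1 + 2 * c) + 0 + (0 + h) ≡ 2 * h * (1 + c)
    at-start₂ = solve-∀

    inside₁ : ∀ {h} c q t → 1 + q + t ≡ h → h * (1 + 2 * c) + (1 + q) + t ≡ 2 * h * (1 + c)
    inside₁ c q t refl = solve c q t
      where
      solve : ∀ c q t → (1 + q + t) * (1 + 2 * c) + (1 + q) + t ≡ 2 * (1 + q + t) * (1 + c)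
      solve = solve-∀
    inside₂ : ∀ {h} c q t → 1 + q + t ≡ h → h * (2 * c) + (1 + q) + (t + h) ≡ 2 * h * (1 + c)
    inside₂ c q t refl = solve c q t
      where
      solve : ∀ c q t → (1 + q + t) * (2 * c) + (1 + q) + (t + (1 + q + t)) ≡ 2 * (1 + q + t) * (1 + c)
      solve = solve-∀

    past₁ : ∀ {h} c h′ → 1 + h′ ≡ h → h * (2 * c) + (1 + h) + h′ ≡ 2 * h * (1 + c)
    past₁ c h′ refl = solve c h′
      where
      solve : ∀ c h′ → (1 + h′) * (2 * c) + (1 + (1 + h′)) + h′ ≡ 2 * (1 + h′) * (1 + c)
      solve = solve-∀
    past₂ : ∀ {h} c h′ → 1 + h′ ≡ h → h * (1 + 2 * c) + (1 + h) + (h′ + h) ≡ 2 * h * (2 + c)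
    past₂ c h′ refl = solve c h′
      where
      solve : ∀ c h′ → (1 + h′) * (1 + 2 * c) + (1 + (1 + h′)) + (h′ + (1 + h′)) ≡ 2 * (1 + h′) * (2 + c)
      solve = solve-∀

    past-end : ∀ {h q n} → h ≤ q → 1 + q + n ≤ h * 3 → 2 * h ≤ 1 + n → q ≡ h
    past-end {h} {q} {n} h≤q le len = ≤-antisym (+-cancelʳ-≤ (2 * h) q h (begin
      q + 2 * h      ≤⟨ +-monoʳ-≤ q len ⟩
      q + (1 + n)    ≡⟨ +-suc q n ⟩
      1 + q + n      ≤⟨ le ⟩
      h * 3          ≡⟨ solve h ⟩
      h + 2 * h      ∎)) h≤q
      where
      open ≤-Reasoning
      solve : ∀ h → h * 3 ≡ h + 2 * h
      solve = solve-∀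

-- u occurs at the same offset p in an even-block and an odd-block occurrence of φ^j(a ā a); whichever
-- of the two reaches a multiple of 2^(j+1) first plays the role of i₁ in Offset.
IsFactorOf-aāa⇒TwoCuts : ∀ j → 2 ≤ j → ∀ u a → 2 * 2 ^ j ≤ suc (length u) → length u ≤ 3 * 2 ^ j →
                          IsFactorOf u (φ^ j (a ∷ not a ∷ a ∷ [])) → TwoCuts j u
IsFactorOf-aāa⇒TwoCuts j 2≤j u a len hi fac with aāa-occurrences a
... | c , c′ , even , odd with IsFactorOf-factor (2 ^ j * (2 * c)) (2 ^ j * 3) u (subst (IsFactorOf u) triple fac)
  where
  triple : φ^ j (a ∷ not a ∷ a ∷ []) ≡ factor (2 ^ j * (2 * c)) (2 ^ j * 3)
  triple = sym (trans (factor-φ^ j (2 * c) 3) (cong (φ^ j) even))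
... | p , p+n≤ , u₁ = offsets p p+n≤ u₁ (trans u₁ (factor-window-≡ p (length u) p+n≤ same-triple))
  where
  open OffsetArithmetic
  h : ℕ
  h = 2 ^ j
  n : ℕ
  n = length u
  E : ℕ
  E = h * (2 * c)
  O : ℕ
  O = h * (1 + 2 * c′)
  same-triple : factor E (h * 3) ≡ factor O (h * 3)
  same-triple = trans (factor-φ^ j (2 * c) 3) (trans (cong (φ^ j) (trans even (sym odd))) (sym (factor-φ^ j (1 + 2 * c′) 3)))
  hi′ : ∀ m → n ≤ m + 3 * h
  hi′ m = ≤-trans hi (m≤n+m (3 * h) m)
  offsets : ∀ p → p + n ≤ h * 3 → u ≡ factor (E + p) n → u ≡ factor (O + p) n → TwoCuts j u
  offsets zero _ uE uO = Offset.twoCuts j 2≤j u len (hi′ 0) (2^>0 j) uE uO (at-start₁ h c) (at-start₂ h c′)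
  offsets (suc q) le uE uO with q <? h
  ... | yes q<h = Offset.twoCuts j 2≤j u len (hi′ t) t<h uO uE (inside₁ c′ q t h≡) (inside₂ c q t h≡)
    where
    t : ℕ
    t = h ∸ suc q
    h≡ : suc q + t ≡ h
    h≡ = m+[n∸m]≡n q<h
    t<h : t < h
    t<h = subst (t <_) h≡ (s≤s (m≤n+m t q))
  ... | no q≮h rewrite past-end {h} {q} {n} (≮⇒≥ q≮h) le len =
    Offset.twoCuts j 2≤j u len (hi′ h′) h′<h uE uO (past₁ c h′ h≡) (past₂ c′ h′ h≡)
    where
    h′ : ℕ
    h′ = h ∸ 1
    h≡ : suc h′ ≡ h
    h≡ = m+[n∸m]≡n (2^>0 j)
    h′<h : h′ < h
    h′<h = subst (h′ <_) h≡ (n<1+n h′)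

InAlternatingTriple⇒TwoCuts : ∀ j → 2 ≤ j → ∀ u → 2 * 2 ^ j ≤ suc (length u) → length u ≤ 3 * 2 ^ j →
                              InAlternatingTriple j u → TwoCuts j u
InAlternatingTriple⇒TwoCuts j 2≤j u len hi (inj₁ fac) = IsFactorOf-aāa⇒TwoCuts j 2≤j u false len hi fac
InAlternatingTriple⇒TwoCuts j 2≤j u len hi (inj₂ fac) = IsFactorOf-aāa⇒TwoCuts j 2≤j u true len hi fac

TwoCuts⇒¬IsSingleton : ∀ j u → TwoCuts j u → ¬ IsSingleton (InCut (suc j) u)
TwoCuts⇒¬IsSingleton j u (C₁ , C₂ , classes , gap , _) (C , _ , unique) = <⇒≢ (2^>0 j) (begin
  0                          ≡⟨ m≡n⇒∣m-n∣≡0 {minL C} refl ⟨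
  ∣ minL C - minL C ∣        ≡⟨ cong₂ (λ x y → ∣ minL x - minL y ∣) C₁≡C C₂≡C ⟨
  ∣ minL C₁ - minL C₂ ∣      ≡⟨ gap ⟩
  2 ^ j                      ∎)
  where
  open ≡-Reasoning
  C₁≡C : C₁ ≡ C
  C₁≡C = unique C₁ (Equivalence.from (classes C₁) (inj₁ refl))
  C₂≡C : C₂ ≡ C
  C₂≡C = unique C₂ (Equivalence.from (classes C₂) (inj₂ refl))

¬InAlternatingTriple⇒IsSingleton : ∀ j → 2 ≤ j → ∀ u → IsFactorT u → 2 * 2 ^ j ≤ suc (length u) →
                                   ¬ InAlternatingTriple j u → IsSingleton (InCut (suc j) u)
¬InAlternatingTriple⇒IsSingleton j 2≤j u (i , u≡) len ¬alt = cutAt (suc j) i n , (i , u≡ , refl) , unique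
  where
  n : ℕ
  n = length u
  u≡factor : ∀ {i} → u ≡ tFactor i n → u ≡ factor i n
  u≡factor {i} eq = trans eq (tFactor≡factor i n)
  unique : ∀ C → InCut (suc j) u C → C ≡ cutAt (suc j) i n
  unique C (i′ , u≡′ , C≡) = trans C≡ (sym (factor≡⇒cutAt≡ j 2≤j len
    (¬alt ∘ subst (InAlternatingTriple j) (sym (u≡factor u≡))) (trans (sym (u≡factor u≡)) (u≡factor u≡′))))

lemma6p7 : (k : ℕ) → 3 ≤ k → (u : Word) → IsFactorT u →
    (2 ^ k) ∸ 1 ≤ length u → length u ≤ 3 * 2 ^ (k ∸ 1) →
    ((¬ IsSingleton (InCut k u)) ⇔
       (IsFactorOf u (φ^ (k ∸ 1) (false ∷ true ∷ false ∷ []))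
        ⊎ IsFactorOf u (φ^ (k ∸ 1) (true ∷ false ∷ true ∷ []))))
    × ((IsFactorOf u (φ^ (k ∸ 1) (false ∷ true ∷ false ∷ []))
        ⊎ IsFactorOf u (φ^ (k ∸ 1) (true ∷ false ∷ true ∷ []))) →
       Σ (List ℕ) λ C₁ → Σ (List ℕ) λ C₂ →
         (∀ C → InCut k u C ⇔ (C ≡ C₁ ⊎ C ≡ C₂))
         × ∣ minL C₁ - minL C₂ ∣ ≡ 2 ^ (k ∸ 1)
         × length (facP C₁ u) < length (facP C₂ u)
         × (Σ Letter λ a →
              ((length (facP C₁ u) + length (facS C₁ u)
                  ≡ length (facP C₂ u) + length (facS C₂ u))
               × (facP C₂ u ≡ facP C₁ u ++ φ^ (k ∸ 1) (a ∷ []))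
               × (φ^ (k ∸ 1) (a ∷ []) ++ facS C₂ u ≡ facS C₁ u))
              ⊎ ((∣ (length (facP C₁ u) + length (facS C₁ u))
                    - (length (facP C₂ u) + length (facS C₂ u)) ∣ ≡ 2 ^ k)
               × (facP C₂ u ≡ facP C₁ u ++ φ^ (k ∸ 1) (not a ∷ []))
               × (facS C₂ u ≡ φ^ (k ∸ 1) (a ∷ []) ++ facS C₁ u))))
lemma6p7 (suc j) (s≤s 2≤j) u factorT lo hi = mk⇔ to from , InAlternatingTriple⇒TwoCuts j 2≤j u len hi
  where
  len : 2 * 2 ^ j ≤ suc (length u)
  len = subst (_≤ suc (length u)) (m+[n∸m]≡n (2^>0 (suc j))) (s≤s lo)
  to : ¬ IsSingleton (InCut (suc j) u) → InAlternatingTriple j u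
  to ¬single with InAlternatingTriple? j u
  ... | yes alt  = alt
  ... | no  ¬alt = ⊥-elim (¬single (¬InAlternatingTriple⇒IsSingleton j 2≤j u factorT len ¬alt))
  from : InAlternatingTriple j u → ¬ IsSingleton (InCut (suc j) u)
  from alt = TwoCuts⇒¬IsSingleton j u (InAlternatingTriple⇒TwoCuts j 2≤j u len hi alt)
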